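{- Let $G$ be a chordal graph with $n$ vertices and leafage $\ell=\ell(G)$. Then the anchor width of $G$ is at most $n^{\ell}$.
   Context: All graphs are finite, simple and undirected. A graph is chordal if it has no induced cycle of length at least $4$; equivalently it is the intersection graph of a family of subtrees of a host tree (a subtree representation). The leafage $\ell(G)$ is the minimum number of leaves of a host tree over all subtree representations of $G$. For $W\subseteq V$ let $N_G^{\cap}(W)=\bigcap_{w\in W}N_G(w)$ (with $N_G^{\cap}(\emptyset)=V$) and $N_G^{\cup}(W)=\bigcup_{w\in W}N_G(w)$, where $N_G(w)$ is the set of neighbors of $w$. For a clique $C$, the periphery is $P_G(C)=N_G^{\cup}(C)\setminus C$; for $M\subseteq P_G(C)$ the anchor set is $A_G(M,C)=N_G^{\cap}(M)\cap C$ when non-empty; $\mathcal{A}_G(C)=\{A\subseteq C\mid A\neq\emptyset,\ \exists M\subseteq P_G(C): A=A_G(M,C)\}$. The anchor width of $G$ is the smallest $k$ such that $|\mathcal{A}_G(C)|\le k$ for every clique $C$ of $G$. -}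

module Defs where

open import Data.Nat using (ℕ; zero; suc; _+_; _≤_; _≤ᵇ_)
open import Data.Nat.DivMod using (_%_)
open import Data.Bool using (Bool; true; false; not; _∧_; _∨_)
open import Data.Fin using (Fin; toℕ)
open import Data.Fin.Subset using (Subset; _∈_; _⊆_; _∩_; ∁; Nonempty; ∣_∣)
open import Data.Vec using (tabulate; lookup)
open import Data.List using (List; []; _∷_; _++_; [_]; length; allFin)
open import Data.Bool.ListAction using (all; any)
open import Data.List.Relation.Unary.All using (All)
open import Data.List.Relation.Unary.Linked using (Linked)
open import Data.List.Relation.Unary.Unique.Propositional using (Unique)
open import Data.Product using (Σ; ∃; _×_)
open import Data.Sum using (_⊎_)
open import Function.Definitions using (Injective)
open import Relation.Binary.PropositionalEquality using (_≡_; _≢_)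
open import Relation.Nullary using (¬_)

record Graph (n : ℕ) : Set where
  field
    adj    : Fin n → Fin n → Bool
    sym    : ∀ u v → adj u v ≡ adj v u
    irrefl : ∀ v → adj v v ≡ false
open Graph public

module _ {n : ℕ} (G : Graph n) where

  Adj : Fin n → Fin n → Set
  Adj u v = adj G u v ≡ true

  Nbr : Fin n → Subset n
  Nbr w = tabulate (adj G w)

  -- N^∩_G(W) (equals V for W = ∅)
  N∩ : Subset n → Subset n
  N∩ W = tabulate λ v → all (λ w → not (lookup W w) ∨ adj G w v) (allFin n)

  N∪ : Subset n → Subset n
  N∪ W = tabulate λ v → any (λ w → lookup W w ∧ adj G w v) (allFin n)

  IsClique : Subset n → Set
  IsClique C = ∀ u v → u ∈ C → v ∈ C → u ≢ v → Adj u v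

  Periphery : Subset n → Subset n
  Periphery C = N∪ C ∩ ∁ C

  IsAnchor : Subset n → Subset n → Set
  IsAnchor C A = Nonempty A × Σ (Subset n) (λ M → M ⊆ Periphery C × A ≡ N∩ M ∩ C)

  AnchorCountAtMost : Subset n → ℕ → Set
  AnchorCountAtMost C k =
    (As : List (Subset n)) → Unique As → All (IsAnchor C) As → length As ≤ k

  AnchorWidthAtMost : ℕ → Set
  AnchorWidthAtMost k = (C : Subset n) → IsClique C → AnchorCountAtMost C k

  data WalkIn (S : Subset n) : Fin n → Fin n → Set where
    here : ∀ {u} → u ∈ S → WalkIn S u u
    step : ∀ {u w v} → u ∈ S → Adj u w → WalkIn S w v → WalkIn S u v

  ConnectedIn : Subset n → Set
  ConnectedIn S = ∀ u v → u ∈ S → v ∈ S → WalkIn S u v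

  Connected : Set
  Connected = ∀ u v → WalkIn (tabulate λ _ → true) u v

  IsCycle : Fin n → List (Fin n) → Set
  IsCycle v vs = 2 ≤ length vs × Unique (v ∷ vs) × Linked Adj (v ∷ vs ++ [ v ])

  Acyclic : Set
  Acyclic = ∀ v vs → ¬ IsCycle v vs

  IsTree : Set
  IsTree = 1 ≤ n × Connected × Acyclic

  numLeaves : ℕ
  numLeaves = ∣ tabulate (λ v → ∣ Nbr v ∣ ≤ᵇ 1) ∣

  CycAdj : ∀ {r} → Fin (4 + r) → Fin (4 + r) → Set
  CycAdj {r} i j = (toℕ j ≡ (toℕ i + 1) % (4 + r)) ⊎ (toℕ i ≡ (toℕ j + 1) % (4 + r))

  IsInducedCycle : ∀ r → (Fin (4 + r) → Fin n) → Set
  IsInducedCycle r c = Injective _≡_ _≡_ c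
    × (∀ i j → (Adj (c i) (c j) → CycAdj i j) × (CycAdj i j → Adj (c i) (c j)))

  Chordal : Set
  Chordal = ∀ r c → ¬ IsInducedCycle r c

module _ {n : ℕ} (G : Graph n) where

  record SubtreeRep : Set where
    field
      m        : ℕ
      host     : Graph m
      hostTree : IsTree host
      sub      : Fin n → Subset m
      subNE    : ∀ v → Nonempty (sub v)
      subConn  : ∀ v → ConnectedIn host (sub v)
      inter    : ∀ u v → u ≢ v → (Adj G u v → Nonempty (sub u ∩ sub v))
                                 × (Nonempty (sub u ∩ sub v) → Adj G u v)

  repLeaves : SubtreeRep → ℕ
  repLeaves R = numLeaves (SubtreeRep.host R)

  HasLeafage : ℕ → Set
  HasLeafage ℓ = Σ SubtreeRep (λ R → repLeaves R ≡ ℓ) × (∀ R → ℓ ≤ repLeaves R)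

module Submission where

-- Fix a subtree representation of G whose host tree has ℓ leaves, and a clique C. By the Helly
-- property the subtrees of the members of C share a node; rooted there, each of these subtrees is
-- closed under ancestors, so a vertex w outside C is adjacent to c ∈ C exactly when the top node of
-- the subtree of w lies in the subtree of c. Assign each w ∈ M ⊆ P(C) to a leaf below its top. The
-- tops assigned to one leaf lie on a single root-to-leaf path, so their contribution to the anchor
-- set is {c ∈ C | x ∈ sub c} for the deepest of them, x. For a fixed leaf these sets form a chain as
-- M varies, so each is determined by its size, one of 1, …, n; and the anchor set of M is their
-- intersection over the ℓ leaves.

open import Defs hiding (sym)
open import Data.Nat using (ℕ; zero; suc; _+_; _∸_; _^_; _≤_; _<_; z≤n; s≤s; z<s; s<s; pred; _≤?_; _≤ᵇ_)
open import Data.Nat.Properties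
open import Data.Bool using (Bool; true; false; not; _∨_)
import Data.Bool.Properties as Bool
open import Data.Bool.Properties using (T-≡)
open import Data.Bool.ListAction using (all)
open import Data.Fin using (Fin; zero; suc; toℕ; fromℕ<; funToFin; finToFun)
import Data.Fin.Properties as Fin
open import Data.Fin.Properties using (pigeonhole; any?; all?; toℕ<n; toℕ-fromℕ<; finToFun-funToFin)
open import Data.Fin.Subset using (Subset; _∈_; _∉_; _⊆_; _∩_; ∣_∣; ⁅_⁆; Nonempty)
open import Data.Fin.Subset.Properties
  using (_∈?_; x∈p∩q⁺; x∈p∩q⁻; x∈∁p⇒x∉p; ∣p∣≤n; ⊆-antisym; drop-∷-⊆; p⊆q⇒∣p∣≤∣q∣; ∣⁅x⁆∣≡1; x∈⁅x⁆; x∈⁅y⁆⇒x≡y)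
open import Data.Vec using ([]; _∷_; tabulate; lookup; here; there)
open import Data.Vec.Properties using ([]=⇒lookup; lookup⇒[]=; lookup∘tabulate)
open import Data.List using (List; []; _∷_; [_]; _++_; length; allFin; filter; applyUpTo; applyDownFrom)
import Data.List as List
open import Data.List.Properties using (length-map; length-++; length-applyUpTo; length-applyDownFrom; ++-assoc)
open import Data.List.Membership.Propositional using () renaming (_∈_ to _∈ₗ_)
open import Data.List.Membership.Propositional.Properties
  using (∈-allFin; ∈-lookup; ∈-filter⁺; ∈-map⁺; ∈-applyUpTo⁻; ∈-applyDownFrom⁻)
open import Data.List.Relation.Unary.All using (All; []; _∷_)
import Data.List.Relation.Unary.All as All
open import Data.List.Relation.Unary.All.Properties using (all⁺; all⁻; all-filter)
open import Data.List.Relation.Unary.Any using (here; there)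
import Data.List.Relation.Unary.Any as Any
open import Data.List.Relation.Unary.Any.Properties using (lookup-index)
open import Data.List.Relation.Unary.AllPairs using (_∷_)
open import Data.List.Relation.Unary.Linked using (Linked; []; [-]; _∷_)
open import Data.List.Relation.Unary.Unique.Propositional using (Unique)
import Data.List.Relation.Unary.Unique.Propositional.Properties as Unique
open import Data.List.Relation.Binary.Disjoint.Propositional using (Disjoint)
open import Data.List.Extrema.Nat using (argmin; argmax; argmin-all; argmax-all; f[argmin]≤f[xs]; f[xs]≤f[argmax])
open import Data.Product using (∃; _×_; _,_; proj₁; proj₂)
open import Data.Sum using (_⊎_; inj₁; inj₂)
open import Data.Empty using (⊥; ⊥-elim)
open import Function using (_∘_; Equivalence; _⇔_; mk⇔)
open import Level using (0ℓ)
open import Relation.Nullary using (¬_; Dec; yes; no; isYes; contradiction; _×-dec_)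
import Relation.Nullary.Decidable as Dec
open import Relation.Nullary.Decidable using (_→-dec_; toWitness; fromWitness)
open import Relation.Unary using (Pred; Decidable)
open import Relation.Binary using (Rel)
open import Relation.Binary.PropositionalEquality
  using (_≡_; _≢_; refl; sym; trans; cong; cong₂; subst; subst₂; module ≡-Reasoning)

open Equivalence using (to; from)

all-allFin⁻ : ∀ {k} {p : Fin k → Bool} → all p (allFin k) ≡ true → ∀ x → p x ≡ true
all-allFin⁻ {k} {p} e x = to T-≡ (All.lookup (all⁺ p (allFin k) (from T-≡ e)) (∈-allFin x))

all-allFin⁺ : ∀ {k} {p : Fin k → Bool} → (∀ x → p x ≡ true) → all p (allFin k) ≡ true
all-allFin⁺ {k} {p} h = to T-≡ (all⁻ p {allFin k} (All.tabulate λ {x} _ → from T-≡ (h x)))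

∈-tabulate⁻ : ∀ {k} {f : Fin k → Bool} {x} → x ∈ tabulate f → f x ≡ true
∈-tabulate⁻ {f = f} {x} x∈ = trans (sym (lookup∘tabulate f x)) ([]=⇒lookup x∈)

∈-tabulate⁺ : ∀ {k} {f : Fin k → Bool} {x} → f x ≡ true → x ∈ tabulate f
∈-tabulate⁺ {f = f} {x} e = lookup⇒[]= x _ (trans (lookup∘tabulate f x) e)

select : ∀ {k} {P : Pred (Fin k) 0ℓ} → Decidable P → Subset k
select P? = tabulate (isYes ∘ P?)

∈-select⁻ : ∀ {k} {P : Pred (Fin k) 0ℓ} {P? : Decidable P} {x} → x ∈ select P? → P x
∈-select⁻ {P? = P?} {x} x∈ = toWitness {a? = P? x} (from T-≡ (∈-tabulate⁻ x∈))

∈-select⁺ : ∀ {k} {P : Pred (Fin k) 0ℓ} {P? : Decidable P} {x} → P x → x ∈ select P?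
∈-select⁺ {P? = P?} {x} px = ∈-tabulate⁺ (to T-≡ (fromWitness {a? = P? x} px))

⊆∧∣≡∣⇒≡ : ∀ {k} {p q : Subset k} → p ⊆ q → ∣ p ∣ ≡ ∣ q ∣ → p ≡ q
⊆∧∣≡∣⇒≡ {p = []} {[]} _ _ = refl
⊆∧∣≡∣⇒≡ {p = true ∷ p} {true ∷ q} p⊆q e = cong (true ∷_) (⊆∧∣≡∣⇒≡ (drop-∷-⊆ p⊆q) (suc-injective e))
⊆∧∣≡∣⇒≡ {p = false ∷ p} {false ∷ q} p⊆q e = cong (false ∷_) (⊆∧∣≡∣⇒≡ (drop-∷-⊆ p⊆q) e)
⊆∧∣≡∣⇒≡ {p = true ∷ p} {false ∷ q} p⊆q e with p⊆q here
... | ()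
⊆∧∣≡∣⇒≡ {p = false ∷ p} {true ∷ q} p⊆q e = contradiction e (<⇒≢ (s≤s (p⊆q⇒∣p∣≤∣q∣ (drop-∷-⊆ p⊆q))))

x∈p⇒1≤∣p∣ : ∀ {k} {p : Subset k} {x} → x ∈ p → 1 ≤ ∣ p ∣
x∈p⇒1≤∣p∣ {p = p} {x} x∈p = subst (_≤ ∣ p ∣) (∣⁅x⁆∣≡1 x) (p⊆q⇒∣p∣≤∣q∣ ⁅x⁆⊆p)
  where
    ⁅x⁆⊆p : ⁅ x ⁆ ⊆ p
    ⁅x⁆⊆p y∈ = subst (_∈ p) (sym (x∈⁅y⁆⇒x≡y x y∈)) x∈p

elements : ∀ {k} → Subset k → List (Fin k)
elements [] = []
elements (true ∷ p) = zero ∷ List.map suc (elements p)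
elements (false ∷ p) = List.map suc (elements p)

length-elements : ∀ {k} (p : Subset k) → length (elements p) ≡ ∣ p ∣
length-elements [] = refl
length-elements (true ∷ p) = cong suc (trans (length-map suc (elements p)) (length-elements p))
length-elements (false ∷ p) = trans (length-map suc (elements p)) (length-elements p)

∈-elements : ∀ {k} {p : Subset k} {x} → x ∈ p → x ∈ₗ elements p
∈-elements {p = true ∷ p} here = here refl
∈-elements {p = true ∷ p} (there x∈p) = there (∈-map⁺ suc (∈-elements x∈p))
∈-elements {p = false ∷ p} (there x∈p) = ∈-map⁺ suc (∈-elements x∈p)

minimal-witness : ∀ {P : Pred ℕ 0ℓ} → Decidable P → ∀ {b} → P b → ∃ λ j → P j × (∀ {i} → i < j → ¬ P i)
minimal-witness P? {zero} pb = 0 , pb , λ ()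
minimal-witness P? {suc b} pb with P? 0
... | yes p0 = 0 , p0 , λ ()
... | no ¬p0 with minimal-witness (P? ∘ suc) {b} pb
...   | j , pj , below = suc j , pj , λ { {zero} _ → ¬p0 ; {suc i} (s≤s i<j) → below i<j }

module _ {k} {P : Pred (Fin k) 0ℓ} (P? : Decidable P) (f : Fin k → ℕ) where

  private
    candidates : List (Fin k)
    candidates = filter P? (allFin k)

    candidate : ∀ {y} → P y → y ∈ₗ candidates
    candidate py = ∈-filter⁺ P? (∈-allFin _) py

  -- abstract keeps the list searches from being unfolded during type checking.
  abstract
    minimiser : ∃ P → ∃ λ t → P t × (∀ {y} → P y → f t ≤ f y)
    minimiser (x , px) =
      argmin f x candidates , argmin-all f px (all-filter P? (allFin k)) ,
      λ py → All.lookup (f[argmin]≤f[xs] x candidates) (candidate py)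

    maximiser : ∃ P → ∃ λ t → P t × (∀ {y} → P y → f y ≤ f t)
    maximiser (x , px) =
      argmax f x candidates , argmax-all f px (all-filter P? (allFin k)) ,
      λ py → All.lookup (f[xs]≤f[argmax] x candidates) (candidate py)

Unique⇒lookup-injective : ∀ {A : Set} {xs : List A} → Unique xs →
                          ∀ {i j} → List.lookup xs i ≡ List.lookup xs j → i ≡ j
Unique⇒lookup-injective {xs = x ∷ xs} (x∉xs ∷ u) {zero} {zero} e = refl
Unique⇒lookup-injective {xs = x ∷ xs} (x∉xs ∷ u) {zero} {suc j} e = contradiction e (All.lookup x∉xs (∈-lookup j))
Unique⇒lookup-injective {xs = x ∷ xs} (x∉xs ∷ u) {suc i} {zero} e = contradiction (sym e) (All.lookup x∉xs (∈-lookup i))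
Unique⇒lookup-injective {xs = x ∷ xs} (x∉xs ∷ u) {suc i} {suc j} e = cong suc (Unique⇒lookup-injective u e)

length≤-by-injection : ∀ {A : Set} {P : A → Set} {K} (code : ∀ x → P x → Fin K) →
                       (∀ {x y} px py → code x px ≡ code y py → x ≡ y) →
                       ∀ {xs} → Unique xs → All P xs → length xs ≤ K
length≤-by-injection code injective {xs} u pxs = ≮⇒≥ too-long
  where
    too-long : ¬ _ < length xs
    too-long K<len with pigeonhole K<len (λ i → code _ (All.lookup pxs (∈-lookup i)))
    ... | i , j , i<j , e = Fin.<⇒≢ i<j (Unique⇒lookup-injective u (injective _ _ e))

∸1< : ∀ {a k} → a ≤ k → 0 < k → a ∸ 1 < k
∸1< {zero} _ 0<k = 0<k
∸1< {suc a} a<k _ = a<k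

∸-offset : ∀ {a b i i′} → i ≤ a → i′ ≤ b → a ≤ b → a ∸ i ≡ b ∸ i′ → i′ ≡ i + (b ∸ a)
∸-offset {a} {b} {i} {i′} i≤a i′≤b a≤b e = +-cancelˡ-≡ (a ∸ i) i′ (i + (b ∸ a)) (begin
  (a ∸ i) + i′            ≡⟨ cong (_+ i′) e ⟩
  (b ∸ i′) + i′           ≡⟨ m∸n+n≡m i′≤b ⟩
  b                       ≡⟨ m+[n∸m]≡n a≤b ⟨
  a + (b ∸ a)             ≡⟨ cong (_+ (b ∸ a)) (m∸n+n≡m i≤a) ⟨
  (a ∸ i) + i + (b ∸ a)   ≡⟨ +-assoc (a ∸ i) i (b ∸ a) ⟩
  (a ∸ i) + (i + (b ∸ a)) ∎)
  where open ≡-Reasoning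

module _ {A : Set} {R : Rel A 0ℓ} where

  Linked-applyUpTo-++ : ∀ (f : ℕ → A) n {ys} → (∀ {i} → i < n → R (f i) (f (suc i))) →
                        Linked R (f n ∷ ys) → Linked R (applyUpTo f (suc n) ++ ys)
  Linked-applyUpTo-++ f zero _ fn∷ys = fn∷ys
  Linked-applyUpTo-++ f (suc n) Rf fn∷ys = Rf z<s ∷ Linked-applyUpTo-++ (f ∘ suc) n (Rf ∘ s<s) fn∷ys

  Linked-applyDownFrom-++ : ∀ (f : ℕ → A) n {ys} → (∀ {i} → i < n → R (f (suc i)) (f i)) →
                            Linked R (f 0 ∷ ys) → Linked R (applyDownFrom f (suc n) ++ ys)
  Linked-applyDownFrom-++ f zero _ f0∷ys = f0∷ys
  Linked-applyDownFrom-++ f (suc n) Rf f0∷ys = Rf ≤-refl ∷ Linked-applyDownFrom-++ f n (Rf ∘ m≤n⇒m≤1+n) f0∷ys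

module _ {n} (G : Graph n) {W : Subset n} {v : Fin n} where

  ∈-N∩⁻ : v ∈ N∩ G W → ∀ {w} → w ∈ W → Adj G w v
  ∈-N∩⁻ v∈ {w} w∈W = subst (λ b → not b ∨ adj G w v ≡ true) ([]=⇒lookup w∈W) (all-allFin⁻ (∈-tabulate⁻ v∈) w)

  ∈-N∩⁺ : (∀ {w} → w ∈ W → Adj G w v) → v ∈ N∩ G W
  ∈-N∩⁺ adjacent = ∈-tabulate⁺ (all-allFin⁺ implication)
    where
      implication : ∀ w → not (lookup W w) ∨ adj G w v ≡ true
      implication w with lookup W w in e
      ... | true = adjacent (lookup⇒[]= w W e)
      ... | false = refl

∈Periphery⇒∉ : ∀ {n} (G : Graph n) {C : Subset n} {w} → w ∈ Periphery G C → w ∉ C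
∈Periphery⇒∉ G w∈P = x∈∁p⇒x∉p (proj₂ (x∈p∩q⁻ _ _ w∈P))

anchor⊆clique : ∀ {n} (G : Graph n) {C A : Subset n} → IsAnchor G C A → A ⊆ C
anchor⊆clique G (_ , _ , _ , refl) a∈A = proj₂ (x∈p∩q⁻ _ _ a∈A)

adj-sym : ∀ {n} (G : Graph n) {u v} → Adj G u v → Adj G v u
adj-sym G {u} {v} uv = trans (Graph.sym G v u) uv

adj⇒≢ : ∀ {n} (G : Graph n) {u v} → Adj G u v → u ≢ v
adj⇒≢ G {u} uv refl with trans (sym (Graph.irrefl G u)) uv
... | ()

module RootedTree {m : ℕ} (H : Graph m) (connected : Connected H) (acyclic : Acyclic H) (root : Fin m) where

  data Within : ℕ → Fin m → Set where
    at-root : ∀ {k} → Within k root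
    via     : ∀ {k y x} → Within k y → Adj H y x → Within (suc k) x

  within? : ∀ k x → Dec (Within k x)
  within? k x with x Fin.≟ root
  ... | yes refl = yes at-root
  within? zero x | no x≢root = no λ { at-root → x≢root refl }
  within? (suc k) x | no x≢root =
    Dec.map′ (λ (y , wy , yx) → via wy yx) step⁻ (any? λ y → within? k y ×-dec (adj H y x Bool.≟ true))
    where
      step⁻ : Within (suc k) x → ∃ λ y → Within k y × Adj H y x
      step⁻ at-root = contradiction refl x≢root
      step⁻ (via wy yx) = _ , wy , yx

  walk⇒within : ∀ {S u v k} → WalkIn H S u v → Within k u → ∃ λ j → Within j v
  walk⇒within (here _) wu = _ , wu
  walk⇒within (step _ uw w⇝v) wu = walk⇒within w⇝v (via wu uw)

  -- abstract, so that with-abstractions over x ≟ root (as in depth-parent) leave depth alone.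
  abstract
    minimal-distance : ∀ x → ∃ λ j → Within j x × (∀ {i} → i < j → ¬ Within i x)
    minimal-distance x = minimal-witness (λ k → within? k x) (proj₂ (walk⇒within (connected root x) (at-root {0})))

    depth : Fin m → ℕ
    depth x = proj₁ (minimal-distance x)

    within-depth : ∀ {x} → Within (depth x) x
    within-depth {x} = proj₁ (proj₂ (minimal-distance x))

    depth-minimal : ∀ {i x} → Within i x → depth x ≤ i
    depth-minimal {i} {x} wx = ≮⇒≥ λ i<depth → proj₂ (proj₂ (minimal-distance x)) i<depth wx

  depth-root : depth root ≡ 0
  depth-root = n≤0⇒n≡0 (depth-minimal (at-root {0}))

  depth≡0⇒≡root : ∀ {x} → depth x ≡ 0 → x ≡ root
  depth≡0⇒≡root {x} e with depth x | within-depth {x}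
  ... | _ | at-root = refl

  0<depth⇒≢root : ∀ {x} → 0 < depth x → x ≢ root
  0<depth⇒≢root 0<d refl = <⇒≢ 0<d (sym depth-root)

  parent-exists : ∀ {x} → x ≢ root → ∃ λ y → Adj H y x × suc (depth y) ≡ depth x
  parent-exists {x} x≢root with depth x in eq | within-depth {x}
  ... | _ | at-root = contradiction refl x≢root
  ... | suc k | via {y = y} wy yx = y , yx , cong suc (≤-antisym (depth-minimal wy) (≤-pred depth-x≤))
    where
      depth-x≤ : suc k ≤ suc (depth y)
      depth-x≤ = subst (_≤ suc (depth y)) eq (depth-minimal (via within-depth yx))

  parent : Fin m → Fin m
  parent x with x Fin.≟ root
  ... | yes _ = root
  ... | no x≢root = proj₁ (parent-exists x≢root)

  parent-root : parent root ≡ root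
  parent-root with root Fin.≟ root
  ... | yes _ = refl
  ... | no root≢root = contradiction refl root≢root

  parent-adj : ∀ {x} → x ≢ root → Adj H (parent x) x
  parent-adj {x} x≢root with x Fin.≟ root
  ... | yes x≡root = contradiction x≡root x≢root
  ... | no x≢root′ = proj₁ (proj₂ (parent-exists x≢root′))

  depth-parent : ∀ x → depth (parent x) ≡ pred (depth x)
  depth-parent x with x Fin.≟ root
  ... | yes x≡root = trans depth-root (sym (cong pred (trans (cong depth x≡root) depth-root)))
  ... | no x≢root = cong pred (proj₂ (proj₂ (parent-exists x≢root)))

  parent^ : ℕ → Fin m → Fin m
  parent^ zero x = x
  parent^ (suc i) x = parent (parent^ i x)

  parent^-+ : ∀ i j x → parent^ (i + j) x ≡ parent^ i (parent^ j x)
  parent^-+ zero j x = refl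
  parent^-+ (suc i) j x = cong parent (parent^-+ i j x)

  parent^-suc : ∀ i x → parent^ (suc i) x ≡ parent^ i (parent x)
  parent^-suc i x = trans (cong (λ k → parent^ k x) (+-comm 1 i)) (parent^-+ i 1 x)

  parent^-root : ∀ i → parent^ i root ≡ root
  parent^-root zero = refl
  parent^-root (suc i) = trans (cong parent (parent^-root i)) parent-root

  depth-parent^ : ∀ i x → depth (parent^ i x) ≡ depth x ∸ i
  depth-parent^ zero x = refl
  depth-parent^ (suc i) x = begin
    depth (parent (parent^ i x)) ≡⟨ depth-parent (parent^ i x) ⟩
    pred (depth (parent^ i x))   ≡⟨ cong pred (depth-parent^ i x) ⟩
    pred (depth x ∸ i)           ≡⟨ pred[m∸n]≡m∸[1+n] (depth x) i ⟩
    depth x ∸ suc i              ∎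
    where open ≡-Reasoning

  parent^-beyond-depth : ∀ {i x} → depth x ≤ i → parent^ i x ≡ root
  parent^-beyond-depth {i} {x} d≤i = depth≡0⇒≡root (trans (depth-parent^ i x) (m≤n⇒m∸n≡0 d≤i))

  parent^-adj : ∀ {i x} → i < depth x → Adj H (parent^ (suc i) x) (parent^ i x)
  parent^-adj {i} {x} i<d = parent-adj (0<depth⇒≢root (subst (0 <_) (sym (depth-parent^ i x)) (m<n⇒0<n∸m i<d)))

  parent^-injective-below : ∀ {i j x} → i < j → j ≤ depth x → parent^ i x ≢ parent^ j x
  parent^-injective-below {i} {j} {x} i<j j≤d e = <⇒≢ (∸-monoʳ-< i<j j≤d) (begin
    depth x ∸ j         ≡⟨ depth-parent^ j x ⟨
    depth (parent^ j x) ≡⟨ cong depth e ⟨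
    depth (parent^ i x) ≡⟨ depth-parent^ i x ⟩
    depth x ∸ i         ∎)
    where open ≡-Reasoning

  infix 4 _≼_ _≼?_

  _≼_ : Fin m → Fin m → Set
  a ≼ y = ∃ λ i → parent^ i y ≡ a

  ≼-canonical : ∀ {a y} → a ≼ y → depth a ≤ depth y × parent^ (depth y ∸ depth a) y ≡ a
  ≼-canonical {a} {y} (i , e) with i ≤? depth y
  ... | yes i≤d = subst (_≤ depth y) (sym depth-a) (m∸n≤m (depth y) i) ,
                  trans (cong (λ k → parent^ k y) (trans (cong (depth y ∸_) depth-a) (m∸[m∸n]≡n i≤d))) e
    where
      depth-a : depth a ≡ depth y ∸ i
      depth-a = trans (cong depth (sym e)) (depth-parent^ i y)
  ... | no i≰d = subst (_≤ depth y) (sym depth-a) z≤n ,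
                 trans (cong (λ k → parent^ k y) (cong (depth y ∸_) depth-a)) (trans (parent^-beyond-depth ≤-refl) (sym a≡root))
    where
      a≡root : a ≡ root
      a≡root = trans (sym e) (parent^-beyond-depth (<⇒≤ (≰⇒> i≰d)))
      depth-a : depth a ≡ 0
      depth-a = trans (cong depth a≡root) depth-root

  _≼?_ : ∀ a y → Dec (a ≼ y)
  a ≼? y = Dec.map′ (depth y ∸ depth a ,_) (proj₂ ∘ ≼-canonical) (parent^ (depth y ∸ depth a) y Fin.≟ a)

  ≼-refl : ∀ {a} → a ≼ a
  ≼-refl = 0 , refl

  root≼ : ∀ y → root ≼ y
  root≼ y = depth y , parent^-beyond-depth ≤-refl

  ≼root⇒≡root : ∀ {a} → a ≼ root → a ≡ root
  ≼root⇒≡root (i , e) = trans (sym e) (parent^-root i)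

  ≼-parent : ∀ {a y} → a ≼ parent y → a ≼ y
  ≼-parent {y = y} (i , e) = suc i , trans (parent^-suc i y) e

  ≼⇒≼parent : ∀ {a y} → a ≼ y → a ≢ y → a ≼ parent y
  ≼⇒≼parent (zero , e) a≢y = contradiction (sym e) a≢y
  ≼⇒≼parent {y = y} (suc i , e) _ = i , trans (sym (parent^-suc i y)) e

  ≼-antisym : ∀ {a b} → a ≼ b → b ≼ a → a ≡ b
  ≼-antisym {a} {b} a≼b b≼a = trans (sym (proj₂ (≼-canonical a≼b))) (cong (λ k → parent^ k b) no-steps)
    where
      no-steps : depth b ∸ depth a ≡ 0
      no-steps = m≤n⇒m∸n≡0 (proj₁ (≼-canonical b≼a))

  ≼-by-depth : ∀ {a b y} → a ≼ y → b ≼ y → depth a ≤ depth b → a ≼ b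
  ≼-by-depth {a} {b} {y} a≼y b≼y da≤db = depth b ∸ depth a , (begin
    parent^ (depth b ∸ depth a) b                               ≡⟨ cong (parent^ (depth b ∸ depth a)) (proj₂ b≼y′) ⟨
    parent^ (depth b ∸ depth a) (parent^ (depth y ∸ depth b) y) ≡⟨ parent^-+ (depth b ∸ depth a) (depth y ∸ depth b) y ⟨
    parent^ ((depth b ∸ depth a) + (depth y ∸ depth b)) y       ≡⟨ cong (λ k → parent^ k y) steps ⟩
    parent^ (depth y ∸ depth a) y                               ≡⟨ proj₂ (≼-canonical a≼y) ⟩
    a                                                           ∎)
    where
      open ≡-Reasoning
      b≼y′ : depth b ≤ depth y × parent^ (depth y ∸ depth b) y ≡ b
      b≼y′ = ≼-canonical b≼y
      steps : (depth b ∸ depth a) + (depth y ∸ depth b) ≡ depth y ∸ depth a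
      steps = begin
        (depth b ∸ depth a) + (depth y ∸ depth b) ≡⟨ +-comm (depth b ∸ depth a) _ ⟩
        (depth y ∸ depth b) + (depth b ∸ depth a) ≡⟨ +-∸-assoc (depth y ∸ depth b) da≤db ⟨
        (depth y ∸ depth b + depth b) ∸ depth a   ≡⟨ cong (_∸ depth a) (m∸n+n≡m (proj₁ b≼y′)) ⟩
        depth y ∸ depth a                         ∎

  ≼-total-below : ∀ {a b y} → a ≼ y → b ≼ y → a ≼ b ⊎ b ≼ a
  ≼-total-below {a} {b} a≼y b≼y with ≤-total (depth a) (depth b)
  ... | inj₁ da≤db = inj₁ (≼-by-depth a≼y b≼y da≤db)
  ... | inj₂ db≤da = inj₂ (≼-by-depth b≼y a≼y db≤da)

  -- u, parent u, …, parent^ j u = parent^ (suc k) v, parent^ k v, …, v is a cycle, closed by the edge v u.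
  no-cycle-through-ancestors : ∀ {u v j k} → Adj H u v → j ≤ depth u → k < depth v →
    parent^ j u ≡ parent^ (suc k) v → (∀ {i i′} → i ≤ j → i′ ≤ k → parent^ i u ≢ parent^ i′ v) →
    1 ≤ j + k → ⊥
  no-cycle-through-ancestors {u} {v} {j} {k} uv j≤du k<dv meet separate 1≤j+k =
    acyclic u (up′ ++ down) (long , unique , linked)
    where
      up′ down : List (Fin m)
      up′ = applyUpTo (λ i → parent^ (suc i) u) j
      down = applyDownFrom (λ i → parent^ i v) (suc k)

      long : 2 ≤ length (up′ ++ down)
      long = subst (2 ≤_) (sym (trans (length-++ up′) (cong₂ _+_ (length-applyUpTo _ j) (length-applyDownFrom _ (suc k)))))
               (subst (2 ≤_) (sym (+-suc j k)) (s≤s 1≤j+k))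

      unique : Unique (u ∷ up′ ++ down)
      unique = Unique.++⁺
        (Unique.applyUpTo⁺₁ _ (suc j) λ i<i′ i′≤j → parent^-injective-below i<i′ (≤-trans (≤-pred i′≤j) j≤du))
        (Unique.applyDownFrom⁺₁ _ (suc k) λ i′<i i≤k → parent^-injective-below i′<i (<⇒≤ (<-≤-trans i≤k k<dv)) ∘ sym)
        disjoint
        where
          disjoint : Disjoint (u ∷ up′) down
          disjoint (x∈up , x∈down) with ∈-applyUpTo⁻ (λ i → parent^ i u) x∈up | ∈-applyDownFrom⁻ _ x∈down
          ... | i , s≤s i≤j , refl | i′ , s≤s i′≤k , e = separate i≤j i′≤k e

      linked : Linked (Adj H) (u ∷ (up′ ++ down) ++ [ u ])
      linked = subst (λ zs → Linked (Adj H) (u ∷ zs)) (sym (++-assoc up′ down [ u ]))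
        (Linked-applyUpTo-++ (λ i → parent^ i u) j (λ i<j → adj-sym H (parent^-adj (<-≤-trans i<j j≤du)))
          (subst (λ z → Adj H z (parent^ k v)) (sym meet) (parent^-adj k<dv)
            ∷ Linked-applyDownFrom-++ (λ i → parent^ i v) k (λ i<k → parent^-adj (<-trans i<k k<dv)) (adj-sym H uv ∷ [-])))

  -- Walk up from u and from v in step at equal depth: the first common vertex closes a cycle through the edge.
  edge-to-non-parent-below : ∀ {u v} → Adj H u v → u ≢ parent v → depth u ≤ depth v → ⊥
  edge-to-non-parent-below {u} {v} uv u≢pv du≤dv = at-first-meeting (minimal-witness Meet? {depth u} meet-at-root)
    where
      e : ℕ
      e = depth v ∸ depth u

      Meet : ℕ → Set
      Meet j = parent^ j u ≡ parent^ (j + e) v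

      Meet? : ∀ j → Dec (Meet j)
      Meet? j = parent^ j u Fin.≟ parent^ (j + e) v

      du+e≡dv : depth u + e ≡ depth v
      du+e≡dv = m+[n∸m]≡n du≤dv

      meet-at-root : Meet (depth u)
      meet-at-root = trans (parent^-beyond-depth ≤-refl) (sym (parent^-beyond-depth {x = v} (≤-reflexive (sym du+e≡dv))))

      at-first-meeting : (∃ λ j → Meet j × (∀ {i} → i < j → ¬ Meet i)) → ⊥
      at-first-meeting (j , meet , first) with j + e in j+e≡
      ... | zero = adj⇒≢ H uv (begin
        u              ≡⟨ cong (λ i → parent^ i u) (m+n≡0⇒m≡0 j j+e≡) ⟨
        parent^ j u    ≡⟨ meet ⟩
        v              ∎)
        where open ≡-Reasoning
      ... | suc k = no-cycle-through-ancestors uv j≤du k<dv meet separate 1≤j+k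
        where
          j≤du : j ≤ depth u
          j≤du = ≮⇒≥ λ du<j → first du<j meet-at-root

          k<dv : k < depth v
          k<dv = subst₂ _≤_ j+e≡ du+e≡dv (+-monoˡ-≤ e j≤du)

          separate : ∀ {i i′} → i ≤ j → i′ ≤ k → parent^ i u ≢ parent^ i′ v
          separate {i} {i′} i≤j i′≤k meet-i = first i<j (trans meet-i (cong (λ s → parent^ s v) i′≡i+e))
            where
              i′≡i+e : i′ ≡ i + e
              i′≡i+e = ∸-offset (≤-trans i≤j j≤du) (≤-trans (m≤n⇒m≤1+n i′≤k) k<dv) du≤dv
                         (trans (sym (depth-parent^ i u)) (trans (cong depth meet-i) (depth-parent^ i′ v)))
              i<j : i < j
              i<j = +-cancelʳ-≤ e (suc i) j (subst₂ _≤_ (cong suc i′≡i+e) (sym j+e≡) (s≤s i′≤k))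

          1≤j+k : 1 ≤ j + k
          1≤j+k = n≢0⇒n>0 λ j+k≡0 → u≢pv (begin
            u                     ≡⟨ cong (λ i → parent^ i u) (m+n≡0⇒m≡0 j j+k≡0) ⟨
            parent^ j u           ≡⟨ meet ⟩
            parent^ (suc k) v     ≡⟨ cong (λ i → parent^ (suc i) v) (m+n≡0⇒n≡0 j j+k≡0) ⟩
            parent v              ∎)
            where open ≡-Reasoning

  edge⇒parent : ∀ {u v} → Adj H u v → u ≡ parent v ⊎ v ≡ parent u
  edge⇒parent {u} {v} uv with u Fin.≟ parent v | v Fin.≟ parent u
  ... | yes u≡pv | _ = inj₁ u≡pv
  ... | no _ | yes v≡pu = inj₂ v≡pu
  ... | no u≢pv | no v≢pu with ≤-total (depth u) (depth v)
  ...   | inj₁ du≤dv = ⊥-elim (edge-to-non-parent-below uv u≢pv du≤dv)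
  ...   | inj₂ dv≤du = ⊥-elim (edge-to-non-parent-below (adj-sym H uv) v≢pu dv≤du)

  ≢root⇒0<depth : ∀ {x} → x ≢ root → 0 < depth x
  ≢root⇒0<depth x≢root = n≢0⇒n>0 (x≢root ∘ depth≡0⇒≡root)

  depth-parent< : ∀ {x} → x ≢ root → depth (parent x) < depth x
  depth-parent< {x} x≢root with depth x | depth-parent x | ≢root⇒0<depth x≢root
  ... | suc d | dp≡d | _ = ≤-reflexive (cong suc dp≡d)

  walk-start : ∀ {S u v} → WalkIn H S u v → u ∈ S
  walk-start (here u∈S) = u∈S
  walk-start (step u∈S _ _) = u∈S

  walk-enters : ∀ {S s y x} → WalkIn H S s y → x ≼ y → ¬ x ≼ s → x ∈ S
  walk-enters (here _) x≼y x⋠s = contradiction x≼y x⋠s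
  walk-enters {x = x} (step {u = s} {w = w} _ sw w⇝y) x≼y x⋠s with x ≼? w
  ... | no x⋠w = walk-enters w⇝y x≼y x⋠w
  ... | yes x≼w with x Fin.≟ w | edge⇒parent sw
  ...   | yes refl | _ = walk-start w⇝y
  ...   | no x≢w | inj₁ s≡pw = contradiction (subst (x ≼_) (sym s≡pw) (≼⇒≼parent x≼w x≢w)) x⋠s
  ...   | no _ | inj₂ w≡ps = contradiction (≼-parent (subst (x ≼_) w≡ps x≼w)) x⋠s

  module _ (S : Subset m) (nonempty : Nonempty S) where

    top : Fin m
    top = proj₁ (minimiser (_∈? S) depth nonempty)

    top∈ : top ∈ S
    top∈ = proj₁ (proj₂ (minimiser (_∈? S) depth nonempty))

    top-minimal : ∀ {y} → y ∈ S → depth top ≤ depth y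
    top-minimal = proj₂ (proj₂ (minimiser (_∈? S) depth nonempty))

    private
      walk-stays-below-top : ∀ {u y} → WalkIn H S u y → top ≼ u → top ≼ y
      walk-stays-below-top (here _) top≼u = top≼u
      walk-stays-below-top (step {u = u} {w = w} _ uw w⇝y) top≼u with top ≼? w
      ... | yes top≼w = walk-stays-below-top w⇝y top≼w
      ... | no top⋠w with edge⇒parent uw
      ...   | inj₁ u≡pw = contradiction (≼-parent (subst (top ≼_) u≡pw top≼u)) top⋠w
      ...   | inj₂ w≡pu with top Fin.≟ u
      ...     | no top≢u = contradiction (subst (top ≼_) (sym w≡pu) (≼⇒≼parent top≼u top≢u)) top⋠w
      ...     | yes refl = ⊥-elim (<⇒≱ (depth-parent< top≢root)
                                      (subst (λ z → depth top ≤ depth z) w≡pu (top-minimal (walk-start w⇝y))))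
        where
          top≢root : top ≢ root
          top≢root top≡root = top⋠w (subst (_≼ w) (sym top≡root) (root≼ w))

    top≼ : ConnectedIn H S → ∀ {y} → y ∈ S → top ≼ y
    top≼ connectedS y∈S = walk-stays-below-top (connectedS top _ top∈ y∈S) ≼-refl

  leaf-below : ∀ x → ∃ λ L → x ≼ L × ∣ Nbr H L ∣ ≤ 1
  leaf-below x with maximiser (x ≼?_) depth (x , ≼-refl)
  ... | L , x≼L , deepest = L , x≼L , subst (∣ Nbr H L ∣ ≤_) (∣⁅x⁆∣≡1 (parent L)) (p⊆q⇒∣p∣≤∣q∣ neighbours⊆parent)
    where
      neighbours⊆parent : Nbr H L ⊆ ⁅ parent L ⁆
      neighbours⊆parent {z} z∈N with edge⇒parent (∈-tabulate⁻ z∈N)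
      ... | inj₂ z≡pL = subst (_∈ ⁅ parent L ⁆) (sym z≡pL) (x∈⁅x⁆ (parent L))
      ... | inj₁ L≡pz = contradiction (deepest (≼-parent (subst (x ≼_) L≡pz x≼L)))
                          (<⇒≱ (subst (_< depth z) (cong depth (sym L≡pz)) (depth-parent< z≢root)))
        where
          z≢root : z ≢ root
          z≢root z≡root = adj⇒≢ H (∈-tabulate⁻ z∈N)
                            (trans L≡pz (trans (cong parent z≡root) (trans parent-root (sym z≡root))))

-- Root the tree anywhere. The deepest top t* = top (T c*) lies in every member T c: T c meets T c* below t*,
-- and the path in T c from its own, higher, top down to that meeting point passes through t*.
helly-subtrees : ∀ {m k} (H : Graph m) → Connected H → Acyclic H →
                 (T : Fin k → Subset m) → (∀ c → Nonempty (T c)) → (∀ c → ConnectedIn H (T c)) →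
                 (C : Subset k) → Nonempty C → (∀ {c c′} → c ∈ C → c′ ∈ C → Nonempty (T c ∩ T c′)) →
                 ∃ λ r → ∀ {c} → c ∈ C → r ∈ T c
helly-subtrees {m} {k} H connected acyclic T nonempty connectedT C C≢∅ meet = t* , t*∈T
  where
    open RootedTree H connected acyclic (proj₁ (nonempty (proj₁ C≢∅)))

    topT : Fin k → Fin m
    topT c = top (T c) (nonempty c)

    deepest : ∃ λ c* → c* ∈ C × (∀ {c} → c ∈ C → depth (topT c) ≤ depth (topT c*))
    deepest = maximiser (_∈? C) (depth ∘ topT) C≢∅

    c* : Fin k
    c* = proj₁ deepest

    t* : Fin m
    t* = topT c*

    t*∈T : ∀ {c} → c ∈ C → t* ∈ T c
    t*∈T {c} c∈C with meet c∈C (proj₁ (proj₂ deepest))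
    ... | y , y∈∩ with x∈p∩q⁻ (T c) (T c*) y∈∩
    ...   | y∈Tc , y∈Tc* with t* ≼? topT c
    ...     | yes t*≼top = subst (_∈ T c) (≼-antisym top≼t* t*≼top) (top∈ (T c) (nonempty c))
      where
        top≼t* : topT c ≼ t*
        top≼t* = ≼-by-depth (top≼ (T c) (nonempty c) (connectedT c) y∈Tc) (top≼ (T c*) (nonempty c*) (connectedT c*) y∈Tc*)
                   (proj₂ (proj₂ deepest) c∈C)
    ...     | no t*⋠top = walk-enters (connectedT c _ _ (top∈ (T c) (nonempty c)) y∈Tc)
                            (top≼ (T c*) (nonempty c*) (connectedT c*) y∈Tc*) t*⋠top

module AnchorCode {n} {G : Graph n} (R : SubtreeRep G) {C : Subset n} (clique : IsClique G C) (C≢∅ : Nonempty C) where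

  open SubtreeRep R

  private
    host-connected : Connected host
    host-connected = proj₁ (proj₂ hostTree)

    host-acyclic : Acyclic host
    host-acyclic = proj₂ (proj₂ hostTree)

  subtrees-meet : ∀ {c c′} → c ∈ C → c′ ∈ C → Nonempty (sub c ∩ sub c′)
  subtrees-meet {c} {c′} c∈C c′∈C with c Fin.≟ c′
  ... | yes refl = proj₁ (subNE c) , x∈p∩q⁺ (proj₂ (subNE c) , proj₂ (subNE c))
  ... | no c≢c′ = proj₁ (inter c c′ c≢c′) (clique c c′ c∈C c′∈C c≢c′)

  private
    common : ∃ λ r → ∀ {c} → c ∈ C → r ∈ sub c
    common = helly-subtrees host host-connected host-acyclic sub subNE subConn C C≢∅ subtrees-meet

  centre : Fin m
  centre = proj₁ common

  centre∈ : ∀ {c} → c ∈ C → centre ∈ sub c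
  centre∈ = proj₂ common

  open RootedTree host host-connected host-acyclic centre

  topOf : Fin n → Fin m
  topOf w = top (sub w) (subNE w)

  ancestor-closed : ∀ {c a b} → c ∈ C → a ≼ b → b ∈ sub c → a ∈ sub c
  ancestor-closed {c} {a} {b} c∈C a≼b b∈ with a ≼? centre
  ... | yes a≼centre = subst (_∈ sub c) (sym (≼root⇒≡root a≼centre)) (centre∈ c∈C)
  ... | no a⋠centre = walk-enters (subConn c centre b (centre∈ c∈C) b∈) a≼b a⋠centre

  adj⇔top∈ : ∀ {w c} → w ∉ C → c ∈ C → Adj G w c ⇔ topOf w ∈ sub c
  adj⇔top∈ {w} {c} w∉C c∈C = mk⇔ top∈sub adjacent
    where
      w≢c : w ≢ c
      w≢c refl = w∉C c∈C

      top∈sub : Adj G w c → topOf w ∈ sub c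
      top∈sub wc with proj₁ (inter w c w≢c) wc
      ... | y , y∈∩ with x∈p∩q⁻ (sub w) (sub c) y∈∩
      ...   | y∈w , y∈c = ancestor-closed c∈C (top≼ (sub w) (subNE w) (subConn w) y∈w) y∈c

      adjacent : topOf w ∈ sub c → Adj G w c
      adjacent t∈c = proj₂ (inter w c w≢c) (topOf w , x∈p∩q⁺ (top∈ (sub w) (subNE w) , t∈c))

  Leaves : Subset m
  Leaves = tabulate (λ v → ∣ Nbr host v ∣ ≤ᵇ 1)

  leafOf : Fin m → Fin m
  leafOf x = proj₁ (leaf-below x)

  ≼leafOf : ∀ x → x ≼ leafOf x
  ≼leafOf x = proj₁ (proj₂ (leaf-below x))

  leafOf∈Leaves : ∀ x → leafOf x ∈ Leaves
  leafOf∈Leaves x = ∈-tabulate⁺ (to T-≡ (≤⇒≤ᵇ (proj₂ (proj₂ (leaf-below x)))))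

  OnBranch : Subset n → Fin m → Fin n → Set
  OnBranch M L w = w ∈ M × leafOf (topOf w) ≡ L

  onBranch? : ∀ M L → Decidable (OnBranch M L)
  onBranch? M L w = (w ∈? M) ×-dec (leafOf (topOf w) Fin.≟ L)

  InBranchAnchor : Subset n → Fin m → Fin n → Set
  InBranchAnchor M L c = c ∈ C × (∀ w → OnBranch M L w → topOf w ∈ sub c)

  -- abstract: with-abstraction over goals mentioning an unfolded branchAnchor is very slow.
  abstract
    branchAnchor : Subset n → Fin m → Subset n
    branchAnchor M L = select λ c → (c ∈? C) ×-dec all? λ w → onBranch? M L w →-dec (topOf w ∈? sub c)

    ∈-branchAnchor⁻ : ∀ {M L c} → c ∈ branchAnchor M L → InBranchAnchor M L c
    ∈-branchAnchor⁻ = ∈-select⁻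

    ∈-branchAnchor⁺ : ∀ {M L c} → InBranchAnchor M L c → c ∈ branchAnchor M L
    ∈-branchAnchor⁺ = ∈-select⁺

  branchAnchor⊆C : ∀ {M L c} → c ∈ branchAnchor M L → c ∈ C
  branchAnchor⊆C c∈B = proj₁ (∈-branchAnchor⁻ c∈B)

  anchor⊆branchAnchor : ∀ {M L c} → M ⊆ Periphery G C → c ∈ N∩ G M ∩ C → c ∈ branchAnchor M L
  anchor⊆branchAnchor M⊆P c∈A with x∈p∩q⁻ _ _ c∈A
  ... | c∈N , c∈C = ∈-branchAnchor⁺ (c∈C , λ w (w∈M , _) →
    to (adj⇔top∈ (∈Periphery⇒∉ G (M⊆P w∈M)) c∈C) (∈-N∩⁻ G c∈N w∈M))

  branchAnchors⊆anchor : ∀ {M c} → M ⊆ Periphery G C → c ∈ C → (∀ {L} → L ∈ Leaves → c ∈ branchAnchor M L) →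
                         c ∈ N∩ G M ∩ C
  branchAnchors⊆anchor {M} {c} M⊆P c∈C c∈Bs = x∈p∩q⁺ (∈-N∩⁺ G adjacent , c∈C)
    where
      adjacent : ∀ {w} → w ∈ M → Adj G w c
      adjacent {w} w∈M = from (adj⇔top∈ (∈Periphery⇒∉ G (M⊆P w∈M)) c∈C)
        (proj₂ (∈-branchAnchor⁻ (c∈Bs (leafOf∈Leaves (topOf w)))) w (w∈M , refl))

  branchAnchor-shape : ∀ M L → (∀ {c} → c ∈ C → c ∈ branchAnchor M L) ⊎
                       ∃ λ x → x ≼ L × (∀ {c} → c ∈ C → c ∈ branchAnchor M L ⇔ x ∈ sub c)
  branchAnchor-shape M L with any? (onBranch? M L)
  ... | no none = inj₁ λ c∈C → ∈-branchAnchor⁺ (c∈C , λ w on → contradiction (w , on) none)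
  ... | yes some with maximiser (onBranch? M L) (depth ∘ topOf) some
  ...   | w* , on* , deepest =
    inj₂ (topOf w* , top≼L on* , λ c∈C → mk⇔ (λ c∈B → proj₂ (∈-branchAnchor⁻ c∈B) w* on*) (top*∈⇒∈ c∈C))
    where
      top≼L : ∀ {w} → OnBranch M L w → topOf w ≼ L
      top≼L {w} (_ , leaf≡L) = subst (topOf w ≼_) leaf≡L (≼leafOf (topOf w))

      top*∈⇒∈ : ∀ {c} → c ∈ C → topOf w* ∈ sub c → c ∈ branchAnchor M L
      top*∈⇒∈ c∈C t*∈c = ∈-branchAnchor⁺ (c∈C , λ w on →
        ancestor-closed c∈C (≼-by-depth (top≼L on) (top≼L on*) (deepest on)) t*∈c)

  branchAnchor-chain : ∀ M M′ L → branchAnchor M L ⊆ branchAnchor M′ L ⊎ branchAnchor M′ L ⊆ branchAnchor M L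
  branchAnchor-chain M M′ L with branchAnchor-shape M L | branchAnchor-shape M′ L
  ... | inj₁ everything | _ = inj₂ (everything ∘ branchAnchor⊆C)
  ... | inj₂ _ | inj₁ everything′ = inj₁ (everything′ ∘ branchAnchor⊆C)
  ... | inj₂ (x , x≼L , B⇔) | inj₂ (x′ , x′≼L , B′⇔) with ≼-total-below x≼L x′≼L
  ...   | inj₁ x≼x′ = inj₂ λ c∈B′ → let c∈C = branchAnchor⊆C c∈B′ in
                        from (B⇔ c∈C) (ancestor-closed c∈C x≼x′ (to (B′⇔ c∈C) c∈B′))
  ...   | inj₂ x′≼x = inj₁ λ c∈B → let c∈C = branchAnchor⊆C c∈B in
                        from (B′⇔ c∈C) (ancestor-closed c∈C x′≼x (to (B⇔ c∈C) c∈B))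

  branchAnchor-≡ : ∀ {M M′ L} → ∣ branchAnchor M L ∣ ≡ ∣ branchAnchor M′ L ∣ →
                   branchAnchor M L ≡ branchAnchor M′ L
  branchAnchor-≡ {M} {M′} {L} e with branchAnchor-chain M M′ L
  ... | inj₁ B⊆B′ = ⊆∧∣≡∣⇒≡ B⊆B′ e
  ... | inj₂ B′⊆B = sym (⊆∧∣≡∣⇒≡ B′⊆B (sym e))

  leaves : List (Fin m)
  leaves = elements Leaves

  0<n : 0 < n
  0<n = <-≤-trans z<s (toℕ<n (proj₁ C≢∅))

  -- |branchAnchor M L| − 1, injective on the sizes 1, …, n, the only ones when M has a nonempty anchor set.
  sizeCode : Subset n → Fin m → Fin n
  sizeCode M L = fromℕ< (∸1< (∣p∣≤n (branchAnchor M L)) 0<n)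

  anchorCode : Subset n → Fin (n ^ length leaves)
  anchorCode M = funToFin λ i → sizeCode M (List.lookup leaves i)

  anchorCode⇒branchAnchor-≡ : ∀ {M M′ L} → anchorCode M ≡ anchorCode M′ → L ∈ Leaves →
                              Nonempty (branchAnchor M L) → Nonempty (branchAnchor M′ L) →
                              branchAnchor M L ≡ branchAnchor M′ L
  anchorCode⇒branchAnchor-≡ {M} {M′} {L} e L∈Leaves (_ , c∈B) (_ , c′∈B′) =
    branchAnchor-≡ (∸-cancelʳ-≡ (x∈p⇒1≤∣p∣ c∈B) (x∈p⇒1≤∣p∣ c′∈B′) (begin
      ∣ branchAnchor M L ∣ ∸ 1   ≡⟨ toℕ-fromℕ< _ ⟨
      toℕ (sizeCode M L)         ≡⟨ cong toℕ same-size ⟩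
      toℕ (sizeCode M′ L)        ≡⟨ toℕ-fromℕ< _ ⟩
      ∣ branchAnchor M′ L ∣ ∸ 1  ∎))
    where
      open ≡-Reasoning
      L∈leaves : L ∈ₗ leaves
      L∈leaves = ∈-elements L∈Leaves

      i : Fin (length leaves)
      i = Any.index L∈leaves

      same-size : sizeCode M L ≡ sizeCode M′ L
      same-size = subst (λ L′ → sizeCode M L′ ≡ sizeCode M′ L′) (sym (lookup-index L∈leaves)) (begin
        sizeCode M (List.lookup leaves i)        ≡⟨ finToFun-funToFin _ i ⟨
        finToFun (anchorCode M) i                ≡⟨ cong (λ code → finToFun code i) e ⟩
        finToFun (anchorCode M′) i               ≡⟨ finToFun-funToFin _ i ⟩
        sizeCode M′ (List.lookup leaves i)       ∎)

  anchorCode-injective : ∀ {A A′} (isA : IsAnchor G C A) (isA′ : IsAnchor G C A′) →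
                         anchorCode (proj₁ (proj₂ isA)) ≡ anchorCode (proj₁ (proj₂ isA′)) → A ≡ A′
  anchorCode-injective ((a , a∈A) , M , M⊆P , refl) ((a′ , a′∈A′) , M′ , M′⊆P , refl) e =
    ⊆-antisym (λ c∈A → branchAnchors⊆anchor M′⊆P (proj₂ (x∈p∩q⁻ _ _ c∈A)) λ L∈ →
                         subst (_ ∈_) (B≡B′ L∈) (anchor⊆branchAnchor M⊆P c∈A))
              (λ c∈A′ → branchAnchors⊆anchor M⊆P (proj₂ (x∈p∩q⁻ _ _ c∈A′)) λ L∈ →
                         subst (_ ∈_) (sym (B≡B′ L∈)) (anchor⊆branchAnchor M′⊆P c∈A′))
    where
      B≡B′ : ∀ {L} → L ∈ Leaves → branchAnchor M L ≡ branchAnchor M′ L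
      B≡B′ L∈ = anchorCode⇒branchAnchor-≡ e L∈ (a , anchor⊆branchAnchor M⊆P a∈A)
                                               (a′ , anchor⊆branchAnchor M′⊆P a′∈A′)

  anchor-count : AnchorCountAtMost G C (n ^ length leaves)
  anchor-count _ = length≤-by-injection (λ _ isA → anchorCode (proj₁ (proj₂ isA))) anchorCode-injective

  length-leaves : length leaves ≡ repLeaves G R
  length-leaves = length-elements Leaves

anchorWidth≤n^leaves : ∀ {n} (G : Graph n) (R : SubtreeRep G) → AnchorWidthAtMost G (n ^ repLeaves G R)
anchorWidth≤n^leaves G R C clique [] _ _ = z≤n
anchorWidth≤n^leaves {n} G R C clique (A ∷ As) unique (isA@((a , a∈A) , _) ∷ anchors) =
  subst (λ ℓ → length (A ∷ As) ≤ n ^ ℓ) length-leaves (anchor-count (A ∷ As) unique (isA ∷ anchors))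
  where open AnchorCode R clique (a , anchor⊆clique G isA a∈A)

-- Any subtree representation gives the bound.
theorem13 : (n : ℕ) (G : Graph n) → Chordal G → (ℓ : ℕ) → HasLeafage G ℓ
    → AnchorWidthAtMost G (n ^ ℓ)
theorem13 n G _ ℓ ((R , refl) , _) = anchorWidth≤n^leaves G R
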